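{- Let $\phi$ and $\Phi$ be as described in the context. Then $\phi\models\Phi$. In countable models, $\Phi\models\phi$.
   Context: Dependence logic extends first-order logic with dependence atoms $=\!(t_1,\ldots,t_n)$ ("the value of $t_n$ is functionally determined by the values of $t_1,\ldots,t_{n-1}$"), with team semantics; a sentence is true in a model $\mathfrak A$ if it is satisfied by the team $\{\emptyset\}$. Let $\phi$ be the sentence $\forall\vec{x_0}\exists\vec{y_0} (\bigwedge_{1\le j\le k}=\!(\vec{w}^{i_j},y_{0,i_j})\wedge \psi(\vec{x_0},\vec{y_0}))$, where $\psi$ is quantifier-free without dependence atoms, $\vec{x_0}=(x_{0,1},\ldots,x_{0,m})$, $\vec{y_0}=(y_{0,1},\ldots,y_{0,n})$, and the variables in $\vec{w}^{i_j}$ are among $x_{0,1},\ldots,x_{0,m},y_{0,1},\ldots,y_{0,i_j-1}$. Let $S$ be the set containing the conjuncts of $\bigwedge_{1\le j\le k}=\!(\vec{w}^{i_j},y_{0,i_j})$ together with $=\!(x_{0,1},\ldots,x_{0,m},y_{0,p})$ for each $y_{0,p}\notin\{y_{0,i_1},\ldots,y_{0,i_k}\}$; write elements of $S$ as $=\!(\vec w_0^p,y_{0,p})$. Define $\vec{x_l}=(x_{l,1},\ldots,x_{l,m})$, $\vec{y_l}=(y_{l,1},\ldots,y_{l,n})$, and $\vec{w}_l^p$ (obtained from $\vec w_0^p$ by replacing each $x_{0,s}$ by $x_{l,s}$ and $y_{0,s}$ by $y_{l,s}$). $\Phi$ is the infinitary game expression $\forall\vec{x_0}\exists\vec{y_0}(\psi(\vec{x_0},\vec{y_0})\wedge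 \forall\vec{x_1}\exists\vec{y_1}(\psi(\vec{x_1},\vec{y_1})\wedge C_1\wedge \forall\vec{x_2}\exists\vec{y_2}(\psi(\vec{x_2},\vec{y_2})\wedge C_2\wedge\cdots)))$, where $C_l=\bigwedge_{0\le i<l}\bigwedge_{=\!(\vec w_0^p,y_{0,p})\in S}(\vec{w}_i^p=\vec{w}_l^p\to y_{i,p}=y_{l,p})$. Truth of $\Phi$ in $\mathfrak A$ means that player II has a winning strategy in the game where, in round $l$, player I picks $\vec a_l$ and player II responds with $\vec b_l$ (elements of $A$), and II wins if the assignment $\vec x_l\mapsto\vec a_l$, $\vec y_l\mapsto\vec b_l$ satisfies $\psi(\vec x_l,\vec y_l)\wedge C_l$ for every $l$. -}

module Defs where

open import Data.Nat using (ℕ; zero; suc; _+_; _<_)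
open import Data.Fin as Fin using (Fin; zero; suc; _↑ʳ_; _↑ˡ_; opposite; toℕ)
open import Data.Vec using (Vec; []; _∷_; tabulate)
open import Data.List using (List; []; _∷_; map; foldr)
open import Data.List.Relation.Unary.All using (All)
open import Data.List.Membership.Propositional using (_∈_)
open import Data.Product using (Σ; Σ-syntax; ∃; _×_; _,_; proj₁)
open import Data.Sum using (_⊎_; inj₁; inj₂)
open import Data.Unit using (⊤)
open import Relation.Nullary using (¬_)
open import Relation.Binary.PropositionalEquality using (_≡_)

record Signature : Set₁ where
  field
    Fun   : Set
    funAr : Fun → ℕ
    Rel   : Set
    relAr : Rel → ℕ
open Signature public

record Structure (L : Signature) : Set₁ where
  field
    Carrier : Set
    funI    : (f : Fun L) → Vec Carrier (funAr L f) → Carrier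
    relI    : (R : Rel L) → Vec Carrier (relAr L R) → Set
open Structure public

XY : ℕ → ℕ → Set
XY m n = Fin m ⊎ Fin n

-- position of the variables inside ∀x₀,₀…∀x₀,ₘ₋₁ ∃y₀,₀…∃y₀,ₙ₋₁
ι : {m n : ℕ} → XY m n → Fin (n + (m + 0))
ι {m} {n} (inj₁ s) = n ↑ʳ (opposite s ↑ˡ 0)
ι {m} {n} (inj₂ p) = opposite p ↑ˡ (m + 0)

DepSpec : ℕ → ℕ → Set
DepSpec m n = List (Fin n × List (XY m n))

-- variables of w in =(w , y₀,ₚ) are among x₀, y₀,₀ … y₀,ₚ₋₁
WFVar : {m n : ℕ} → Fin n → XY m n → Set
WFVar p (inj₁ _) = ⊤
WFVar p (inj₂ q) = q Fin.< p

WellFormed : {m n : ℕ} → DepSpec m n → Set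
WellFormed ds = All (λ d → All (WFVar (proj₁ d)) (Data.Product.proj₂ d)) ds

allX : (m : ℕ) {n : ℕ} → List (XY m n)
allX m = map inj₁ (Data.List.allFin m)

InS : {m n : ℕ} → DepSpec m n → Fin n → List (XY m n) → Set
InS {m} ds p w = ((p , w) ∈ ds) ⊎ (¬ (p ∈ map proj₁ ds) × (w ≡ allX m))


module _ {L : Signature} where

  data Term (V : Set) : Set where
    var : V → Term V
    app : (f : Fun L) → Vec (Term V) (funAr L f) → Term V

  data QF (V : Set) : Set where
    _≐_  : Term V → Term V → QF V
    rel  : (R : Rel L) → Vec (Term V) (relAr L R) → QF V
    neg  : QF V → QF V
    _∧ᶠ_ : QF V → QF V → QF V
    _∨ᶠ_ : QF V → QF V → QF V

  mutual
    renT : {V W : Set} → (V → W) → Term V → Term W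
    renT ι (var x) = var (ι x)
    renT ι (app f ts) = app f (renTs ι ts)

    renTs : {V W : Set} {j : ℕ} → (V → W) → Vec (Term V) j → Vec (Term W) j
    renTs ι [] = []
    renTs ι (t ∷ ts) = renT ι t ∷ renTs ι ts

  renQF : {V W : Set} → (V → W) → QF V → QF W
  renQF ι (t ≐ u) = renT ι t ≐ renT ι u
  renQF ι (rel R ts) = rel R (renTs ι ts)
  renQF ι (neg θ) = neg (renQF ι θ)
  renQF ι (θ ∧ᶠ χ) = renQF ι θ ∧ᶠ renQF ι χ
  renQF ι (θ ∨ᶠ χ) = renQF ι θ ∨ᶠ renQF ι χ

  module _ (𝔄 : Structure L) where
    private A = Carrier 𝔄

    mutual
      evalT : {V : Set} → (V → A) → Term V → A
      evalT ρ (var x) = ρ x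
      evalT ρ (app f ts) = funI 𝔄 f (evalTs ρ ts)

      evalTs : {V : Set} {j : ℕ} → (V → A) → Vec (Term V) j → Vec A j
      evalTs ρ [] = []
      evalTs ρ (t ∷ ts) = evalT ρ t ∷ evalTs ρ ts

    Holds : {V : Set} → QF V → (V → A) → Set
    Holds (t ≐ u) ρ = evalT ρ t ≡ evalT ρ u
    Holds (rel R ts) ρ = relI 𝔄 R (evalTs ρ ts)
    Holds (neg θ) ρ = ¬ Holds θ ρ
    Holds (θ ∧ᶠ χ) ρ = Holds θ ρ × Holds χ ρ
    Holds (θ ∨ᶠ χ) ρ = Holds θ ρ ⊎ Holds χ ρ

  -- Variables are de Bruijn indices: DL k has k free variables, the
  -- most recently bound variable is 'zero'.

  data DL (k : ℕ) : Set where
    fo   : QF (Fin k) → DL k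
    dep  : List (Fin k) → Fin k → DL k
    _∧ᵈ_ : DL k → DL k → DL k
    all  : DL (suc k) → DL k
    ex   : DL (suc k) → DL k

  module _ (𝔄 : Structure L) where
    private A = Carrier 𝔄

    Team : ℕ → Set₁
    Team k = (Fin k → A) → Set

    Sat : {k : ℕ} → Team k → DL k → Set
    Sat X (fo θ) = ∀ s → X s → Holds 𝔄 θ s
    Sat X (dep ws v) = ∀ s s′ → X s → X s′ →
                         All (λ w → s w ≡ s′ w) ws → s v ≡ s′ v
    Sat X (φ ∧ᵈ χ) = Sat X φ × Sat X χ
    Sat X (all φ) = Sat (λ s → X (λ i → s (suc i))) φ
    -- ∃F : X → A such that X[F/x] ⊨ φ
    Sat X (ex φ) =
      Σ[ F ∈ ((s : Fin _ → A) → X s → A) ]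
        Sat (λ s → Σ[ h ∈ X (λ i → s (suc i)) ] s zero ≡ F (λ i → s (suc i)) h) φ

    -- truth of a sentence: satisfied by the team {∅}
    _⊨ᵈ_ : DL 0 → Set
    _⊨ᵈ_ φ = Sat (λ _ → ⊤) φ

  -- quantifier blocks ∀x₁…∀xⱼ and ∃y₁…∃yⱼ (outermost quantifier first)
  ∀ⁿ : (j : ℕ) {k : ℕ} → DL (j + k) → DL k
  ∀ⁿ zero φ = φ
  ∀ⁿ (suc j) φ = ∀ⁿ j (all φ)

  ∃ⁿ : (j : ℕ) {k : ℕ} → DL (j + k) → DL k
  ∃ⁿ zero φ = φ
  ∃ⁿ (suc j) φ = ∃ⁿ j (ex φ)

  -- The sentence φ.  Variables of ψ: inj₁ s = x₀,ₛ , inj₂ p = y₀,ₚ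
  -- (0-based).  A dependence conjunct =(w, y₀,ₚ) is a pair (p , w).

  φ-sentence : (m n : ℕ) → QF (XY m n) → DepSpec m n → DL 0
  φ-sentence m n ψ ds =
    ∀ⁿ m (∃ⁿ n (foldr (λ d χ → dep (map ι (Data.Product.proj₂ d)) (ι (inj₂ (proj₁ d))) ∧ᵈ χ)
                       (fo (renQF ι ψ)) ds))

  module _ (𝔄 : Structure L) where
    private A = Carrier 𝔄

    -- a strategy of player II: in round l, given I's moves a₀ … aₗ,
    -- answer bₗ
    StrategyII : ℕ → ℕ → Set
    StrategyII m n = (l : ℕ) → Vec (Fin m → A) (suc l) → (Fin n → A)

    IImove : {m n : ℕ} → StrategyII m n → (ℕ → Fin m → A) → ℕ → Fin n → A
    IImove σ α l = σ l (tabulate (λ (i : Fin (suc l)) → α (toℕ i)))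

    round : {m n : ℕ} → StrategyII m n → (ℕ → Fin m → A) → ℕ → XY m n → A
    round σ α l (inj₁ s) = α l s
    round σ α l (inj₂ p) = IImove σ α l p

    C : {m n : ℕ} → DepSpec m n → ((ℕ → XY m n → A)) → ℕ → Set
    C ds ρ l = ∀ i → i < l → ∀ p w → InS ds p w →
                 All (λ v → ρ i v ≡ ρ l v) w → ρ i (inj₂ p) ≡ ρ l (inj₂ p)

    Winning : {m n : ℕ} → QF (XY m n) → DepSpec m n → StrategyII m n → Set
    Winning ψ ds σ = ∀ (α : ℕ → _) (l : ℕ) →
      Holds 𝔄 ψ (round σ α l) × C ds (round σ α) l

    ΦTrue : {m n : ℕ} → QF (XY m n) → DepSpec m n → Set
    ΦTrue {m} {n} ψ ds = Σ[ σ ∈ StrategyII m n ] Winning ψ ds σ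

  -- countable model: there is a surjection ℕ → domain
  -- (models have nonempty domains)
  Countable : Structure L → Set
  Countable 𝔄 = Σ[ e ∈ (ℕ → Carrier 𝔄) ] (∀ a → ∃ λ i → e i ≡ a)

-- Both φ and Φ say that ψ has Skolem functions y₀ = f(x₀) obeying the
-- dependence atoms of S.  For φ this is team-semantic Skolemisation.  For Φ,
-- player II answering every round with f wins, and conversely, in a countable
-- model player I can play every tuple of A^m in some round; II's answer in
-- that round defines f, and the conditions C_l between rounds are exactly the
-- dependence atoms of S for f.
module Submission where

open import Defs
open import Data.Nat using (ℕ; zero; suc; _+_)
open import Data.Nat.Properties using (+-identityʳ; +-suc; <-cmp)
open import Data.Fin as Fin using (Fin; zero; suc; _↑ʳ_; _↑ˡ_; opposite; toℕ; fromℕ)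
open import Data.Fin.Properties using (opposite-involutive; toℕ-cast; toℕ-↑ˡ; toℕ-fromℕ; toℕ-injective)
open import Data.Vec as Vec using (Vec; lookup; tabulate)
open import Data.Vec.Properties using (lookup∘tabulate; tabulate-cong)
open import Data.Vec.Functional using (_∷_)
open import Data.List as List using (List; map; foldr)
open import Data.List.Relation.Unary.All as All using (All)
open import Data.List.Relation.Unary.All.Properties using (map⁺; map⁻)
open import Data.List.Relation.Unary.Any using (here; there)
open import Data.List.Membership.Propositional using (_∈_)
open import Data.List.Membership.Propositional.Properties using (∈-map⁺; ∈-allFin)
open import Data.Product using (Σ-syntax; ∃; _×_; _,_; proj₁; proj₂)
open import Data.Sum using (inj₁; inj₂; [_,_]′)
open import Data.Unit using (⊤; tt)
open import Function using (_∘_)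
open import Relation.Binary using (_Preserves_⟶_; tri<; tri≈; tri>)
open import Relation.Binary.PropositionalEquality
open ≡-Reasoning

step : ℕ × ℕ → ℕ × ℕ
step (zero , b) = suc b , 0
step (suc a , b) = a , suc b

unpair : ℕ → ℕ × ℕ
unpair zero = 0 , 0
unpair (suc k) = step (unpair k)

triangle : ℕ → ℕ
triangle zero = 0
triangle (suc d) = suc (triangle d + d)

unpair-walk : ∀ b a k → unpair k ≡ (a + b , 0) → unpair (k + b) ≡ (a , b)
unpair-walk zero a k e = begin
  unpair (k + 0)  ≡⟨ cong unpair (+-identityʳ k) ⟩
  unpair k        ≡⟨ e ⟩
  (a + 0 , 0)     ≡⟨ cong (_, 0) (+-identityʳ a) ⟩
  (a , 0)         ∎
unpair-walk (suc b) a k e = begin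
  unpair (k + suc b)     ≡⟨ cong unpair (+-suc k b) ⟩
  step (unpair (k + b))  ≡⟨ cong step (unpair-walk b (suc a) k (trans e (cong (_, 0) (+-suc a b)))) ⟩
  (a , suc b)            ∎

unpair-triangle : ∀ d → unpair (triangle d) ≡ (d , 0)
unpair-triangle zero = refl
unpair-triangle (suc d) = cong step (unpair-walk d 0 (triangle d) (unpair-triangle d))

unpair-surjective : ∀ a b → ∃ λ k → unpair k ≡ (a , b)
unpair-surjective a b = triangle (a + b) + b , unpair-walk b a (triangle (a + b)) (unpair-triangle (a + b))

module _ {A : Set} (e : ℕ → A) where

  tuples : (m : ℕ) → ℕ → Fin m → A
  tuples zero k ()
  tuples (suc m) k zero = e (proj₁ (unpair k))
  tuples (suc m) k (suc s) = tuples m (proj₂ (unpair k)) s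

  tuples-surjective : (∀ a → ∃ λ i → e i ≡ a) →
    (m : ℕ) (a : Fin m → A) → ∃ λ k → tuples m k ≗ a
  tuples-surjective e-surj zero a = 0 , λ ()
  tuples-surjective e-surj (suc m) a
    with e-surj (a zero) | tuples-surjective e-surj m (a ∘ suc)
  ... | i , eᵢ | j , eⱼ with unpair-surjective i j
  ... | k , eₖ = k , λ where
    zero → trans (cong (e ∘ proj₁) eₖ) eᵢ
    (suc s) → trans (cong (λ ij → tuples m (proj₂ ij) s) eₖ) (eⱼ s)

-- Data.Vec.Functional._++_ does not reduce on (suc i); this one does, so that
-- ((x ∷ g) ++′ t) ∘ suc is definitionally g ++′ t, which Skolemisation of ∃ⁿ needs.
_++′_ : {A : Set} {j k : ℕ} → (Fin j → A) → (Fin k → A) → Fin (j + k) → A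
_++′_ {j = zero} g t i = t i
_++′_ {j = suc j} g t zero = g zero
_++′_ {j = suc j} g t (suc i) = ((g ∘ suc) ++′ t) i

++′-↑ˡ : {A : Set} {j k : ℕ} (g : Fin j → A) (t : Fin k → A) (i : Fin j) →
  (g ++′ t) (i ↑ˡ k) ≡ g i
++′-↑ˡ g t zero = refl
++′-↑ˡ g t (suc i) = ++′-↑ˡ (g ∘ suc) t i

++′-↑ʳ : {A : Set} (j : ℕ) {k : ℕ} (g : Fin j → A) (t : Fin k → A) (i : Fin k) →
  (g ++′ t) (j ↑ʳ i) ≡ t i
++′-↑ʳ zero g t i = refl
++′-↑ʳ (suc j) g t i = ++′-↑ʳ j (g ∘ suc) t i

module _ {V A : Set} where

  AgreeOn : List V → (V → A) → (V → A) → Set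
  AgreeOn w ρ ρ′ = All (λ v → ρ v ≡ ρ′ v) w

  AgreeOn-sym : {w : List V} {ρ ρ′ : V → A} → AgreeOn w ρ ρ′ → AgreeOn w ρ′ ρ
  AgreeOn-sym = All.map sym

  AgreeOn-cong : {w : List V} {ρ₁ ρ₂ σ₁ σ₂ : V → A} →
    ρ₁ ≗ σ₁ → ρ₂ ≗ σ₂ → AgreeOn w ρ₁ ρ₂ → AgreeOn w σ₁ σ₂
  AgreeOn-cong e₁ e₂ = All.map (λ {v} agree → trans (sym (e₁ v)) (trans agree (e₂ v)))

cast-↑ˡ0 : {m : ℕ} (i : Fin m) → Fin.cast (+-identityʳ m) (i ↑ˡ 0) ≡ i
cast-↑ˡ0 {m} i = toℕ-injective (trans (toℕ-cast (+-identityʳ m) (i ↑ˡ 0)) (toℕ-↑ˡ i 0))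

module _ {A : Set} {m : ℕ} where

  -- In the context of ∀ⁿ m, the variable x₀,ₛ has de Bruijn index opposite s.
  readX : (Fin (m + 0) → A) → Fin m → A
  readX t s = t (opposite s ↑ˡ 0)

  -- Going through a Vec turns a ≗ a′ into storeX a ≡ storeX a′; this makes the
  -- Skolem function read off φ extensional, as the atoms =(x₀, y₀,ₚ) of S require.
  storeX : (Fin m → A) → Fin (m + 0) → A
  storeX a j = lookup (tabulate a) (opposite (Fin.cast (+-identityʳ m) j))

  storeX-cong : {a a′ : Fin m → A} → a ≗ a′ → storeX a ≡ storeX a′
  storeX-cong e = cong (λ v j → lookup v (opposite (Fin.cast (+-identityʳ m) j))) (tabulate-cong e)

  readX∘storeX : (a : Fin m → A) → readX (storeX a) ≗ a
  readX∘storeX a s = begin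
    lookup (tabulate a) (opposite (Fin.cast _ (opposite s ↑ˡ 0)))
      ≡⟨ cong (lookup (tabulate a) ∘ opposite) (cast-↑ˡ0 (opposite s)) ⟩
    lookup (tabulate a) (opposite (opposite s))
      ≡⟨ cong (lookup (tabulate a)) (opposite-involutive s) ⟩
    lookup (tabulate a) s
      ≡⟨ lookup∘tabulate a s ⟩
    a s ∎

  module _ {n : ℕ} where

    _⊕_ : (Fin m → A) → (Fin n → A) → XY m n → A
    a ⊕ b = [ a , b ]′

    ⊕-congˡ : {a a′ : Fin m → A} (b : Fin n → A) → a ≗ a′ → a ⊕ b ≗ a′ ⊕ b
    ⊕-congˡ b e (inj₁ s) = e s
    ⊕-congˡ b e (inj₂ p) = refl

    ⊕-congʳ : (a : Fin m → A) {b b′ : Fin n → A} → b ≗ b′ → a ⊕ b ≗ a ⊕ b′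
    ⊕-congʳ a e (inj₁ s) = refl
    ⊕-congʳ a e (inj₂ p) = e p

    ++′∘ι : (g : Fin n → A) (t : Fin (m + 0) → A) → (g ++′ t) ∘ ι ≗ readX t ⊕ (g ∘ opposite)
    ++′∘ι g t (inj₁ s) = ++′-↑ʳ n g t (opposite s ↑ˡ 0)
    ++′∘ι g t (inj₂ p) = ++′-↑ˡ g t (opposite p)

    AgreeOn-allX : {ρ ρ′ : XY m n → A} → AgreeOn (allX m) ρ ρ′ → ρ ∘ inj₁ ≗ ρ′ ∘ inj₁
    AgreeOn-allX agree s = All.lookup agree (∈-map⁺ inj₁ (∈-allFin s))

module _ {L : Signature} (𝔄 : Structure L) where
  private A = Carrier 𝔄

  mutual
    evalT-cong : {V : Set} {ρ ρ′ : V → A} → ρ ≗ ρ′ → (t : Term {L} V) → evalT 𝔄 ρ t ≡ evalT 𝔄 ρ′ t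
    evalT-cong e (var x) = e x
    evalT-cong e (app f ts) = cong (funI 𝔄 f) (evalTs-cong e ts)

    evalTs-cong : {V : Set} {ρ ρ′ : V → A} {j : ℕ} → ρ ≗ ρ′ →
      (ts : Vec (Term {L} V) j) → evalTs 𝔄 ρ ts ≡ evalTs 𝔄 ρ′ ts
    evalTs-cong e Vec.[] = refl
    evalTs-cong e (t Vec.∷ ts) = cong₂ Vec._∷_ (evalT-cong e t) (evalTs-cong e ts)

  Holds-cong : {V : Set} {ρ ρ′ : V → A} → ρ ≗ ρ′ → (θ : QF {L} V) → Holds 𝔄 θ ρ → Holds 𝔄 θ ρ′
  Holds-cong e (t ≐ u) h = trans (sym (evalT-cong e t)) (trans h (evalT-cong e u))
  Holds-cong e (rel R ts) h = subst (relI 𝔄 R) (evalTs-cong e ts) h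
  Holds-cong e (neg θ) h h′ = h (Holds-cong (sym ∘ e) θ h′)
  Holds-cong e (θ ∧ᶠ χ) (hθ , hχ) = Holds-cong e θ hθ , Holds-cong e χ hχ
  Holds-cong e (θ ∨ᶠ χ) (inj₁ hθ) = inj₁ (Holds-cong e θ hθ)
  Holds-cong e (θ ∨ᶠ χ) (inj₂ hχ) = inj₂ (Holds-cong e χ hχ)

  mutual
    evalT-renT : {V W : Set} (f : V → W) (ρ : W → A) (t : Term {L} V) →
      evalT 𝔄 ρ (renT f t) ≡ evalT 𝔄 (ρ ∘ f) t
    evalT-renT f ρ (var x) = refl
    evalT-renT f ρ (app g ts) = cong (funI 𝔄 g) (evalTs-renTs f ρ ts)

    evalTs-renTs : {V W : Set} {j : ℕ} (f : V → W) (ρ : W → A) (ts : Vec (Term {L} V) j) →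
      evalTs 𝔄 ρ (renTs f ts) ≡ evalTs 𝔄 (ρ ∘ f) ts
    evalTs-renTs f ρ Vec.[] = refl
    evalTs-renTs f ρ (t Vec.∷ ts) = cong₂ Vec._∷_ (evalT-renT f ρ t) (evalTs-renTs f ρ ts)

  mutual
    Holds-renQF⁻ : {V W : Set} (f : V → W) (ρ : W → A) (θ : QF {L} V) →
      Holds 𝔄 (renQF f θ) ρ → Holds 𝔄 θ (ρ ∘ f)
    Holds-renQF⁻ f ρ (t ≐ u) h = trans (sym (evalT-renT f ρ t)) (trans h (evalT-renT f ρ u))
    Holds-renQF⁻ f ρ (rel R ts) h = subst (relI 𝔄 R) (evalTs-renTs f ρ ts) h
    Holds-renQF⁻ f ρ (neg θ) h h′ = h (Holds-renQF⁺ f ρ θ h′)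
    Holds-renQF⁻ f ρ (θ ∧ᶠ χ) (hθ , hχ) = Holds-renQF⁻ f ρ θ hθ , Holds-renQF⁻ f ρ χ hχ
    Holds-renQF⁻ f ρ (θ ∨ᶠ χ) (inj₁ hθ) = inj₁ (Holds-renQF⁻ f ρ θ hθ)
    Holds-renQF⁻ f ρ (θ ∨ᶠ χ) (inj₂ hχ) = inj₂ (Holds-renQF⁻ f ρ χ hχ)

    Holds-renQF⁺ : {V W : Set} (f : V → W) (ρ : W → A) (θ : QF {L} V) →
      Holds 𝔄 θ (ρ ∘ f) → Holds 𝔄 (renQF f θ) ρ
    Holds-renQF⁺ f ρ (t ≐ u) h = trans (evalT-renT f ρ t) (trans h (sym (evalT-renT f ρ u)))
    Holds-renQF⁺ f ρ (rel R ts) h = subst (relI 𝔄 R) (sym (evalTs-renTs f ρ ts)) h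
    Holds-renQF⁺ f ρ (neg θ) h h′ = h (Holds-renQF⁻ f ρ θ h′)
    Holds-renQF⁺ f ρ (θ ∧ᶠ χ) (hθ , hχ) = Holds-renQF⁺ f ρ θ hθ , Holds-renQF⁺ f ρ χ hχ
    Holds-renQF⁺ f ρ (θ ∨ᶠ χ) (inj₁ hθ) = inj₁ (Holds-renQF⁺ f ρ θ hθ)
    Holds-renQF⁺ f ρ (θ ∨ᶠ χ) (inj₂ hχ) = inj₂ (Holds-renQF⁺ f ρ χ hχ)

  Sat-subteam : {k : ℕ} {X Y : Team 𝔄 k} → (∀ s → Y s → X s) →
    (φ : DL {L} k) → Sat 𝔄 X φ → Sat 𝔄 Y φ
  Sat-subteam Y⊆X (fo θ) h s y = h s (Y⊆X s y)
  Sat-subteam Y⊆X (dep ws v) h s s′ y y′ = h s s′ (Y⊆X s y) (Y⊆X s′ y′)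
  Sat-subteam Y⊆X (φ ∧ᵈ χ) (hφ , hχ) = Sat-subteam Y⊆X φ hφ , Sat-subteam Y⊆X χ hχ
  Sat-subteam Y⊆X (all φ) h = Sat-subteam (λ s → Y⊆X (s ∘ suc)) φ h
  Sat-subteam Y⊆X (ex φ) (F , h) =
    (λ s y → F s (Y⊆X s y)) , Sat-subteam (λ s (y , e) → Y⊆X (s ∘ suc) y , e) φ h

  Sat-∀ⁿ⁻ : (j : ℕ) {k : ℕ} (X : Team 𝔄 k) (φ : DL {L} (j + k)) →
    Sat 𝔄 X (∀ⁿ j φ) → Sat 𝔄 (λ s → X (λ i → s (j ↑ʳ i))) φ
  Sat-∀ⁿ⁻ zero X φ h = h
  Sat-∀ⁿ⁻ (suc j) X φ h = Sat-∀ⁿ⁻ j X (all φ) h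

  Sat-∀ⁿ⁺ : (j : ℕ) {k : ℕ} (X : Team 𝔄 k) (φ : DL {L} (j + k)) →
    Sat 𝔄 (λ s → X (λ i → s (j ↑ʳ i))) φ → Sat 𝔄 X (∀ⁿ j φ)
  Sat-∀ⁿ⁺ zero X φ h = h
  Sat-∀ⁿ⁺ (suc j) X φ h = Sat-∀ⁿ⁺ j X (all φ) h

  Graph : {j k : ℕ} → ((Fin k → A) → Fin j → A) → Team 𝔄 (j + k)
  Graph G s = Σ[ t ∈ _ ] s ≡ G t ++′ t

  Graph≗ : {j k : ℕ} → ((Fin k → A) → Fin j → A) → Team 𝔄 (j + k)
  Graph≗ G s = Σ[ t ∈ _ ] s ≗ G t ++′ t

  -- The witnesses of the ∃-block need not be extensional, so the team they
  -- produce is only the strict graph; conversely a pointwise graph suffices.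
  Sat-∃ⁿ⁻ : (j : ℕ) {k : ℕ} (φ : DL {L} (j + k)) →
    Sat 𝔄 (λ _ → ⊤) (∃ⁿ j φ) → Σ[ G ∈ ((Fin k → A) → Fin j → A) ] Sat 𝔄 (Graph G) φ
  Sat-∃ⁿ⁻ zero φ h = (λ t ()) , Sat-subteam (λ _ _ → tt) φ h
  Sat-∃ⁿ⁻ (suc j) {k} φ h with Sat-∃ⁿ⁻ j (ex φ) h
  ... | G′ , F , h′ = G , Sat-subteam graph⊆ φ h′
    where
      G : (Fin k → A) → Fin (suc j) → A
      G t = F (G′ t ++′ t) (t , refl) ∷ G′ t

      graph⊆ : ∀ s → Graph G s → Σ[ g ∈ Graph G′ (s ∘ suc) ] s zero ≡ F (s ∘ suc) g
      graph⊆ s (t , refl) = (t , refl) , refl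

  Sat-∃ⁿ⁺ : (j : ℕ) {k : ℕ} (G : (Fin k → A) → Fin j → A) (φ : DL {L} (j + k)) →
    Sat 𝔄 (Graph≗ G) φ → Sat 𝔄 (λ _ → ⊤) (∃ⁿ j φ)
  Sat-∃ⁿ⁺ zero G φ h = Sat-subteam (λ s _ → s , λ _ → refl) φ h
  Sat-∃ⁿ⁺ (suc j) {k} G φ h = Sat-∃ⁿ⁺ j (λ t → G t ∘ suc) (ex φ) (F , Sat-subteam ⊆graph φ h)
    where
      F : (s : Fin (j + k) → A) → Graph≗ (λ t → G t ∘ suc) s → A
      F s (t , _) = G t zero

      ⊆graph : ∀ s → Σ[ g ∈ Graph≗ (λ t → G t ∘ suc) (s ∘ suc) ] s zero ≡ F (s ∘ suc) g → Graph≗ G s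
      ⊆graph s ((t , e) , e₀) = t , λ where
        zero → e₀
        (suc i) → e i

  body : {m n : ℕ} → QF {L} (XY m n) → DepSpec m n → DL {L} (n + (m + 0))
  body ψ ds = foldr (λ d χ → dep (map ι (proj₂ d)) (ι (inj₂ (proj₁ d))) ∧ᵈ χ) (fo (renQF ι ψ)) ds

  Sat-body⁻ : {m n : ℕ} (ψ : QF {L} (XY m n)) (ds : DepSpec m n) {X : Team 𝔄 (n + (m + 0))} →
    Sat 𝔄 X (body ψ ds) →
    Sat 𝔄 X (fo (renQF ι ψ)) × (∀ {p w} → (p , w) ∈ ds → Sat 𝔄 X (dep (map ι w) (ι (inj₂ p))))
  Sat-body⁻ ψ List.[] h = h , λ ()
  Sat-body⁻ ψ (d List.∷ ds) (hd , h) with Sat-body⁻ ψ ds h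
  ... | hψ , hds = hψ , λ where
    (here refl) → hd
    (there mem) → hds mem

  Sat-body⁺ : {m n : ℕ} (ψ : QF {L} (XY m n)) (ds : DepSpec m n) {X : Team 𝔄 (n + (m + 0))} →
    Sat 𝔄 X (fo (renQF ι ψ)) → (∀ {p w} → (p , w) ∈ ds → Sat 𝔄 X (dep (map ι w) (ι (inj₂ p)))) →
    Sat 𝔄 X (body ψ ds)
  Sat-body⁺ ψ List.[] hψ hds = hψ
  Sat-body⁺ ψ (d List.∷ ds) hψ hds = hds (here refl) , Sat-body⁺ ψ ds hψ (hds ∘ there)

  module _ {m n : ℕ} (ψ : QF {L} (XY m n)) (ds : DepSpec m n) where

    record IsSkolemFunction (f : (Fin m → A) → Fin n → A) : Set where
      field
        satisfies : ∀ a → Holds 𝔄 ψ (a ⊕ f a)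
        dependsOn : ∀ {p w} → (p , w) ∈ ds → ∀ a a′ → AgreeOn w (a ⊕ f a) (a′ ⊕ f a′) → f a p ≡ f a′ p
    open IsSkolemFunction

    Sat-body⇒skolem : {X : Team 𝔄 (n + (m + 0))} {f : (Fin m → A) → Fin n → A} →
      Sat 𝔄 X (body ψ ds) → (∀ a → Σ[ s ∈ _ ] X s × s ∘ ι ≗ a ⊕ f a) → IsSkolemFunction f
    Sat-body⇒skolem {f = f} sat witness = record { satisfies = satisfies′ ; dependsOn = dependsOn′ }
      where
        satisfies′ : ∀ a → Holds 𝔄 ψ (a ⊕ f a)
        satisfies′ a with witness a
        ... | s , x , e = Holds-cong e ψ (Holds-renQF⁻ ι s ψ (proj₁ (Sat-body⁻ ψ ds sat) s x))

        dependsOn′ : ∀ {p w} → (p , w) ∈ ds → ∀ a a′ → AgreeOn w (a ⊕ f a) (a′ ⊕ f a′) → f a p ≡ f a′ p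
        dependsOn′ {p} mem a a′ agree with witness a | witness a′
        ... | s , x , e | s′ , x′ , e′ = begin
          f a p            ≡⟨ e (inj₂ p) ⟨
          s (ι (inj₂ p))   ≡⟨ proj₂ (Sat-body⁻ ψ ds sat) mem s s′ x x′ (map⁺ (AgreeOn-cong (sym ∘ e) (sym ∘ e′) agree)) ⟩
          s′ (ι (inj₂ p))  ≡⟨ e′ (inj₂ p) ⟩
          f a′ p           ∎

    skolem⇒Sat-body : {X : Team 𝔄 (n + (m + 0))} {f : (Fin m → A) → Fin n → A} →
      IsSkolemFunction f → (∀ s → X s → Σ[ a ∈ _ ] s ∘ ι ≗ a ⊕ f a) → Sat 𝔄 X (body ψ ds)
    skolem⇒Sat-body {X} {f} sk reading = Sat-body⁺ ψ ds hψ hds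
      where
        hψ : Sat 𝔄 X (fo (renQF ι ψ))
        hψ s x with reading s x
        ... | a , e = Holds-renQF⁺ ι s ψ (Holds-cong (sym ∘ e) ψ (satisfies sk a))

        hds : ∀ {p w} → (p , w) ∈ ds → Sat 𝔄 X (dep (map ι w) (ι (inj₂ p)))
        hds {p} mem s s′ x x′ agree with reading s x | reading s′ x′
        ... | a , e | a′ , e′ = begin
          s (ι (inj₂ p))   ≡⟨ e (inj₂ p) ⟩
          f a p            ≡⟨ dependsOn sk mem a a′ (AgreeOn-cong e e′ (map⁻ agree)) ⟩
          f a′ p           ≡⟨ e′ (inj₂ p) ⟨
          s′ (ι (inj₂ p))  ∎

    sentence⇒skolem : 𝔄 ⊨ᵈ φ-sentence m n ψ ds →
      Σ[ f ∈ ((Fin m → A) → Fin n → A) ] IsSkolemFunction f × f Preserves _≗_ ⟶ _≗_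
    sentence⇒skolem h with Sat-∃ⁿ⁻ n (body ψ ds) (Sat-∀ⁿ⁻ m (λ _ → ⊤) _ h)
    ... | G , sat = f , Sat-body⇒skolem sat witness , λ e p → cong (λ t → G t (opposite p)) (storeX-cong e)
      where
        f : (Fin m → A) → Fin n → A
        f a = G (storeX a) ∘ opposite

        witness : ∀ a → Σ[ s ∈ _ ] Graph G s × s ∘ ι ≗ a ⊕ f a
        witness a = G (storeX a) ++′ storeX a , (storeX a , refl) ,
          λ v → trans (++′∘ι (G (storeX a)) (storeX a) v) (⊕-congˡ (f a) (readX∘storeX a) v)

    skolem⇒sentence : {f : (Fin m → A) → Fin n → A} → IsSkolemFunction f → 𝔄 ⊨ᵈ φ-sentence m n ψ ds
    skolem⇒sentence {f} sk =
      Sat-∀ⁿ⁺ m (λ _ → ⊤) _ (Sat-∃ⁿ⁺ n G (body ψ ds) (skolem⇒Sat-body sk reading))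
      where
        G : (Fin (m + 0) → A) → Fin n → A
        G t = f (readX t) ∘ opposite

        reading : ∀ s → Graph≗ G s → Σ[ a ∈ _ ] s ∘ ι ≗ a ⊕ f a
        reading s (t , e) = readX t ,
          λ v → trans (e (ι v)) (trans (++′∘ι (G t) t v)
                  (⊕-congʳ (readX t) (cong (f (readX t)) ∘ opposite-involutive) v))

    answerLatest : ((Fin m → A) → Fin n → A) → StrategyII 𝔄 m n
    answerLatest f l as = f (lookup as (fromℕ l))

    round-answerLatest : (f : (Fin m → A) → Fin n → A) (α : ℕ → Fin m → A) (l : ℕ) →
      round 𝔄 (answerLatest f) α l ≗ α l ⊕ f (α l)
    round-answerLatest f α l (inj₁ s) = refl
    round-answerLatest f α l (inj₂ p) = cong (λ a → f a p)
      (trans (lookup∘tabulate (α ∘ toℕ) (fromℕ l)) (cong α (toℕ-fromℕ l)))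

    skolem⇒Φ : {f : (Fin m → A) → Fin n → A} →
      IsSkolemFunction f → f Preserves _≗_ ⟶ _≗_ → ΦTrue 𝔄 ψ ds
    skolem⇒Φ {f} sk f-cong = answerLatest f , λ α l →
      Holds-cong (sym ∘ round-answerLatest f α l) ψ (satisfies sk (α l)) , C-holds α l
      where
        C-holds : ∀ α l → C 𝔄 ds (round 𝔄 (answerLatest f) α) l
        C-holds α l i _ p w S agree = begin
          round 𝔄 (answerLatest f) α i (inj₂ p)  ≡⟨ round-answerLatest f α i (inj₂ p) ⟩
          f (α i) p                               ≡⟨ atom S ⟩
          f (α l) p                               ≡⟨ round-answerLatest f α l (inj₂ p) ⟨
          round 𝔄 (answerLatest f) α l (inj₂ p)  ∎
          where
            atom : InS ds p w → f (α i) p ≡ f (α l) p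
            atom (inj₁ mem) = dependsOn sk mem (α i) (α l)
              (AgreeOn-cong (round-answerLatest f α i) (round-answerLatest f α l) agree)
            atom (inj₂ (_ , refl)) = f-cong (AgreeOn-allX agree) p

    winning-consistent : {σ : StrategyII 𝔄 m n} → Winning 𝔄 ψ ds σ →
      ∀ α l l′ {p w} → InS ds p w → AgreeOn w (round 𝔄 σ α l) (round 𝔄 σ α l′) →
      IImove 𝔄 σ α l p ≡ IImove 𝔄 σ α l′ p
    winning-consistent win α l l′ S agree with <-cmp l l′
    ... | tri< l<l′ _ _ = proj₂ (win α l′) l l<l′ _ _ S agree
    ... | tri≈ _ refl _ = refl
    ... | tri> _ _ l′<l = sym (proj₂ (win α l) l′ l′<l _ _ S (AgreeOn-sym agree))

    Φ⇒skolem : Countable 𝔄 → ΦTrue 𝔄 ψ ds → Σ[ f ∈ ((Fin m → A) → Fin n → A) ] IsSkolemFunction f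
    Φ⇒skolem (e , e-surj) (σ , win) = f , record
      { satisfies = λ a → Holds-cong (round-code a) ψ (proj₁ (win α (code a)))
      ; dependsOn = λ mem a a′ agree → winning-consistent win α (code a) (code a′) (inj₁ mem)
          (AgreeOn-cong (sym ∘ round-code a) (sym ∘ round-code a′) agree)
      }
      where
        α : ℕ → Fin m → A
        α = tuples e m

        code : (Fin m → A) → ℕ
        code a = proj₁ (tuples-surjective e e-surj m a)

        f : (Fin m → A) → Fin n → A
        f a = IImove 𝔄 σ α (code a)

        round-code : ∀ a → round 𝔄 σ α (code a) ≗ a ⊕ f a
        round-code a (inj₁ s) = proj₂ (tuples-surjective e e-surj m a) s
        round-code a (inj₂ p) = refl

proposition12 : {L : Signature} (m n : ℕ) (ψ : QF {L} (XY m n))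
    (ds : DepSpec m n) → WellFormed ds →
    ((𝔄 : Structure L) → 𝔄 ⊨ᵈ φ-sentence m n ψ ds → ΦTrue 𝔄 ψ ds)
    × ((𝔄 : Structure L) → Countable 𝔄 → ΦTrue 𝔄 ψ ds → 𝔄 ⊨ᵈ φ-sentence m n ψ ds)
proposition12 m n ψ ds _ =
    (λ 𝔄 φ-true → let (f , skolem , f-cong) = sentence⇒skolem 𝔄 ψ ds φ-true
                  in skolem⇒Φ 𝔄 ψ ds skolem f-cong)
  , (λ 𝔄 countable Φ-true → skolem⇒sentence 𝔄 ψ ds (proj₂ (Φ⇒skolem 𝔄 ψ ds countable Φ-true)))
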